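{- Let $f\colon (X',\tau',\leqslant')\to (X,\tau,\leqslant)$ be a map between partially ordered topological spaces. Suppose that for every $x\in X'$ there exists an open upset $U_x\subseteq X'$ with $x\in U_x$ such that the image $f[U_x]=\{f(u)\mid u\in U_x\}$ is an open upset of $X$ and the restriction $f|_{U_x}\colon U_x\to f[U_x]$ is a homeomorphism both with respect to the subspace topologies induced by $\tau'$ and $\tau$ and with respect to the upset topologies. Then $f$ is an open, continuous, strict $p$-morphism.
   Context: A subset $A$ of a poset is an upset if $a\in A$ and $a\leqslant a'$ imply $a'\in A$. The upset topology on a poset is the (Alexandroff) topology whose open sets are exactly the upsets. For $x$ in a poset, $\uparrow x=\{x'\mid x\leqslant x'\}$. A map $f\colon X'\to X$ of posets is a $p$-morphism if it is order-preserving and satisfies the "back" condition: whenever $x\in X'$, $y\in X$ and $f(x)\leqslant y$, there is $x'\geqslant x$ with $f(x')=y$. It is a strict $p$-morphism if, moreover, such $x'$ is always unique. -}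

module Defs where

open import Level using (0ℓ)
open import Data.Product using (Σ; Σ-syntax; ∃-syntax; _×_; _,_)
open import Data.Unit using (⊤)
open import Relation.Unary using (Pred; _∈_; _⊆_; _≐_; _∩_)
open import Relation.Binary.Core using (Rel)
open import Relation.Binary.Structures using (IsPartialOrder)
open import Relation.Binary.PropositionalEquality using (_≡_)

-- Since subsets are predicates, openness is required to respect
-- extensional equality of subsets (≐).  The empty set is open as the
-- union of the empty family.
record Topology (X : Set) : Set₁ where
  field
    Open     : Pred (Pred X 0ℓ) 0ℓ
    Open-≐   : ∀ {A B : Pred X 0ℓ} → A ≐ B → Open A → Open B
    Open-all : Open (λ _ → ⊤)
    Open-⋃   : ∀ {I : Set} (A : I → Pred X 0ℓ) →
               (∀ i → Open (A i)) → Open (λ x → Σ[ i ∈ I ] A i x)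
    Open-∩   : ∀ {A B : Pred X 0ℓ} → Open A → Open B → Open (A ∩ B)

record POTS : Set₁ where
  field
    Carrier   : Set
    _≤_       : Rel Carrier 0ℓ
    isPartialOrder : IsPartialOrder _≡_ _≤_
    topology  : Topology Carrier
  open Topology topology public

module _ {X : Set} (_≤_ : Rel X 0ℓ) where

  IsUpset : Pred (Pred X 0ℓ) 0ℓ
  IsUpset A = ∀ {a a'} → a ∈ A → a ≤ a' → a' ∈ A

  ↑ : X → Pred X 0ℓ
  ↑ x = λ x' → x ≤ x'

preimage : {X' X : Set} → (X' → X) → Pred X 0ℓ → Pred X' 0ℓ
preimage f B x = f x ∈ B

image : {X' X : Set} → (X' → X) → Pred X' 0ℓ → Pred X 0ℓ
image f A y = ∃[ u ] (u ∈ A × f u ≡ y)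

RelOpen : {X : Set} → Pred (Pred X 0ℓ) 0ℓ → Pred X 0ℓ → Pred X 0ℓ → Set₁
RelOpen Open V S = ∃[ W ] (Open W × S ≐ (V ∩ W))

-- The restriction  f|U : U → f[U]  is a homeomorphism, where U carries the
-- subspace topology coming from Open' and f[U] the one coming from Open:
-- f|U is a bijection (it is surjective onto f[U] by definition, so we
-- require injectivity on U), it is continuous (preimages of relatively
-- open subsets of f[U] are relatively open in U) and its inverse is
-- continuous, i.e. f|U is open (images of relatively open subsets of U
-- are relatively open in f[U]).
RestrictionHomeo : {X' X : Set} →
  Pred (Pred X' 0ℓ) 0ℓ → Pred (Pred X 0ℓ) 0ℓ →
  (X' → X) → Pred X' 0ℓ → Set₁
RestrictionHomeo Open' Open f U =
  (∀ {u v} → u ∈ U → v ∈ U → f u ≡ f v → u ≡ v)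
  × (∀ (T : Pred _ 0ℓ) → T ⊆ image f U → RelOpen Open (image f U) T →
       RelOpen Open' U (U ∩ (preimage f T)))
  × (∀ (S : Pred _ 0ℓ) → S ⊆ U → RelOpen Open' U S →
       RelOpen Open (image f U) (image f S))

module _ (X' X : POTS) (f : POTS.Carrier X' → POTS.Carrier X) where
  private
    module X' = POTS X'
    module X  = POTS X

  IsContinuous : Set₁
  IsContinuous = ∀ (V : Pred X.Carrier 0ℓ) → X.Open V → X'.Open (preimage f V)

  IsOpenMap : Set₁
  IsOpenMap = ∀ (A : Pred X'.Carrier 0ℓ) → X'.Open A → X.Open (image f A)

  IsOrderPreserving : Set
  IsOrderPreserving = ∀ {x y} → x X'.≤ y → f x X.≤ f y

  IsStrictPMorphism : Set
  IsStrictPMorphism =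
    IsOrderPreserving
    × (∀ x y → f x X.≤ y →
         Σ[ x' ∈ X'.Carrier ] ((x X'.≤ x' × f x' ≡ y)
           × (∀ x'' → x X'.≤ x'' → f x'' ≡ y → x'' ≡ x')))

  LocalHomeoAt : X'.Carrier → Pred X'.Carrier 0ℓ → Set₁
  LocalHomeoAt x U =
    x ∈ U × X'.Open U × IsUpset X'._≤_ U
    × X.Open (image f U) × IsUpset X._≤_ (image f U)
    × RestrictionHomeo X'.Open X.Open f U
    × RestrictionHomeo (IsUpset X'._≤_) (IsUpset X._≤_) f U

-- Openness and continuity are local, so the τ-homeomorphisms f|U_x give them.
-- Everything order-theoretic comes from f|U_x being a homeomorphism for the
-- upset topologies as well: continuity makes the preimage of ↑ f(x) in U_x an
-- upset containing x, so f is monotone; openness makes f[U_x ∩ ↑ x] an upset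
-- containing f(x), so every y ≥ f(x) lifts above x.  The lift is unique because
-- U_x is an upset, hence contains every x' ≥ x, and f is injective on U_x.
module Submission where

open import Defs
open import Level using (0ℓ)
open import Data.Product using (Σ; Σ-syntax; ∃-syntax; _×_; _,_; proj₁; proj₂)
open import Data.Unit using (tt)
open import Relation.Unary using (Pred; _∈_; _⊆_; _∩_; ⋃)
open import Relation.Unary.Properties using (≐-refl; ≐-sym)
open import Relation.Binary.Core using (Rel)
open import Relation.Binary.Definitions using (Transitive)
open import Relation.Binary.Structures using (IsPartialOrder)
open import Relation.Binary.PropositionalEquality using (_≡_; refl; sym; trans)

↑-isUpset : {X : Set} {_≤_ : Rel X 0ℓ} → Transitive _≤_ → ∀ x → IsUpset _≤_ (↑ _≤_ x)
↑-isUpset ≤-trans _ x≤a a≤a' = ≤-trans x≤a a≤a'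

upsetTopology : {X : Set} → Rel X 0ℓ → Topology X
upsetTopology _≤_ = record
  { Open     = IsUpset _≤_
  ; Open-≐   = λ (A⊆B , B⊆A) A-up b∈B b≤b' → A⊆B (A-up (B⊆A b∈B) b≤b')
  ; Open-all = λ _ _ → tt
  ; Open-⋃   = λ A A-up (i , a∈Ai) a≤a' → i , A-up i a∈Ai a≤a'
  ; Open-∩   = λ A-up B-up (a∈A , a∈B) a≤a' → A-up a∈A a≤a' , B-up a∈B a≤a'
  }

relOpen-∩ : {X : Set} {Open : Pred (Pred X 0ℓ) 0ℓ} {V W : Pred X 0ℓ} →
            Open W → RelOpen Open V (V ∩ W)
relOpen-∩ W-open = _ , W-open , ≐-refl

module _ {X : Set} (τ : Topology X) where
  open Topology τ

  relOpen⇒open : ∀ {V S : Pred X 0ℓ} → Open V → RelOpen Open V S → Open S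
  relOpen⇒open V-open (W , W-open , S≐V∩W) = Open-≐ (≐-sym S≐V∩W) (Open-∩ V-open W-open)

  Open-local : ∀ {A : Pred X 0ℓ} →
               (∀ {x} → x ∈ A → ∃[ B ] (Open B × x ∈ B × B ⊆ A)) → Open A
  Open-local {A} nbhd = Open-≐ (⋃⊆A , A⊆⋃) (Open-⋃ B B-open)
    where
    B : Σ X (_∈ A) → Pred X 0ℓ
    B (_ , x∈A) = proj₁ (nbhd x∈A)

    B-open : ∀ i → Open (B i)
    B-open (_ , x∈A) = proj₁ (proj₂ (nbhd x∈A))

    ⋃⊆A : ⋃ _ B ⊆ A
    ⋃⊆A ((_ , x∈A) , y∈B) = proj₂ (proj₂ (proj₂ (nbhd x∈A))) y∈B

    A⊆⋃ : A ⊆ ⋃ _ B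
    A⊆⋃ x∈A = (_ , x∈A) , proj₁ (proj₂ (proj₂ (nbhd x∈A)))

RestrictionContinuous RestrictionOpen : {X' X : Set} →
  Pred (Pred X' 0ℓ) 0ℓ → Pred (Pred X 0ℓ) 0ℓ → (X' → X) → Pred X' 0ℓ → Set₁
RestrictionContinuous Open' Open f U =
  ∀ (T : Pred _ 0ℓ) → T ⊆ image f U → RelOpen Open (image f U) T →
  RelOpen Open' U (U ∩ preimage f T)
RestrictionOpen Open' Open f U =
  ∀ (S : Pred _ 0ℓ) → S ⊆ U → RelOpen Open' U S →
  RelOpen Open (image f U) (image f S)

module _ {X' X : Set} (τ' : Topology X') (τ : Topology X) (f : X' → X) {U : Pred X' 0ℓ} where
  private
    module τ' = Topology τ'
    module τ = Topology τ

  image-∩-open : τ.Open (image f U) → RestrictionOpen τ'.Open τ.Open f U →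
                 ∀ {A} → τ'.Open A → τ.Open (image f (U ∩ A))
  image-∩-open fU-open f-open A-open =
    relOpen⇒open τ fU-open (f-open _ proj₁ (relOpen-∩ A-open))

  ∩-preimage-open : τ'.Open U → RestrictionContinuous τ'.Open τ.Open f U →
                    ∀ {V} → τ.Open V → τ'.Open (U ∩ preimage f (image f U ∩ V))
  ∩-preimage-open U-open f-cont V-open =
    relOpen⇒open τ' U-open (f-cont _ proj₁ (relOpen-∩ V-open))

module _ (X' X : POTS) (f : POTS.Carrier X' → POTS.Carrier X)
         (chart : ∀ x → Σ[ U ∈ Pred (POTS.Carrier X') 0ℓ ] LocalHomeoAt X' X f x U) where
  private
    module X' = POTS X'
    module X  = POTS X
    module ≤' = IsPartialOrder X'.isPartialOrder
    module ≤  = IsPartialOrder X.isPartialOrder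

  local-homeo⇒open : IsOpenMap X' X f
  local-homeo⇒open A A-open = Open-local X.topology nbhd
    where
    nbhd : ∀ {y} → y ∈ image f A → ∃[ B ] (X.Open B × y ∈ B × B ⊆ image f A)
    nbhd (u , u∈A , refl) with chart u
    ... | U , u∈U , _ , _ , fU-open , _ , (_ , _ , homeo-open) , _ =
      image f (U ∩ A) ,
      image-∩-open X'.topology X.topology f fU-open homeo-open A-open ,
      (u , (u∈U , u∈A) , refl) ,
      λ (v , (_ , v∈A) , fv≡y) → v , v∈A , fv≡y

  local-homeo⇒continuous : IsContinuous X' X f
  local-homeo⇒continuous V V-open = Open-local X'.topology nbhd
    where
    nbhd : ∀ {x} → x ∈ preimage f V → ∃[ B ] (X'.Open B × x ∈ B × B ⊆ preimage f V)
    nbhd {x} fx∈V with chart x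
    ... | U , x∈U , U-open , _ , _ , _ , (_ , homeo-cont , _) , _ =
      U ∩ preimage f (image f U ∩ V) ,
      ∩-preimage-open X'.topology X.topology f U-open homeo-cont V-open ,
      (x∈U , (x , x∈U , refl) , fx∈V) ,
      λ (_ , _ , fz∈V) → fz∈V

  local-homeo⇒order-preserving : IsOrderPreserving X' X f
  local-homeo⇒order-preserving {x} x≤y with chart x
  ... | U , x∈U , _ , U-up , _ , _ , _ , (_ , homeo-cont , _) =
    proj₂ (proj₂ (↑fx-preimage-up (x∈U , (x , x∈U , refl) , ≤.refl) x≤y))
    where
    ↑fx-preimage-up : IsUpset X'._≤_ (U ∩ preimage f (image f U ∩ ↑ X._≤_ (f x)))
    ↑fx-preimage-up = ∩-preimage-open (upsetTopology X'._≤_) (upsetTopology X._≤_) f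
                        U-up homeo-cont (↑-isUpset {_≤_ = X._≤_} ≤.trans (f x))

  local-homeo⇒unique-lift : ∀ x y → f x X.≤ y →
    Σ[ x' ∈ X'.Carrier ] ((x X'.≤ x' × f x' ≡ y)
      × (∀ x'' → x X'.≤ x'' → f x'' ≡ y → x'' ≡ x'))
  local-homeo⇒unique-lift x y fx≤y with chart x
  ... | U , x∈U , _ , U-up , _ , fU-up , (injective , _ , _) , (_ , _ , homeo-open)
    with image-∩-open (upsetTopology X'._≤_) (upsetTopology X._≤_) f fU-up homeo-open
           (↑-isUpset {_≤_ = X'._≤_} ≤'.trans x) (x , (x∈U , ≤'.refl) , refl) fx≤y
  ... | x' , (x'∈U , x≤x') , fx'≡y =
    x' , (x≤x' , fx'≡y) ,
    λ x'' x≤x'' fx''≡y → injective (U-up x∈U x≤x'') x'∈U (trans fx''≡y (sym fx'≡y))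

lemma7 : (X' X : POTS) (f : POTS.Carrier X' → POTS.Carrier X) →
           (∀ (x : POTS.Carrier X') →
              Σ[ U ∈ Pred (POTS.Carrier X') 0ℓ ] LocalHomeoAt X' X f x U) →
           IsOpenMap X' X f × IsContinuous X' X f × IsStrictPMorphism X' X f
lemma7 X' X f chart =
  local-homeo⇒open X' X f chart ,
  local-homeo⇒continuous X' X f chart ,
  local-homeo⇒order-preserving X' X f chart ,
  local-homeo⇒unique-lift X' X f chart
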